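{- For any monotone Boolean function (family) $f\in\mathsf{NP}/\mathrm{poly}\cap\mathsf{coNP}/\mathrm{poly}$ on inputs $\bar z$, there are polynomial-size $3$-CNF formulas $\phi_0(\bar x,\bar z)$ and $\phi_1(\bar y,\bar z)$, with $\bar x,\bar y,\bar z$ pairwise disjoint, such that for every Boolean assignment $\bar\alpha$ to $\bar z$: $f(\bar\alpha)=0$ if and only if $\phi_0(\bar x,\bar\alpha)$ is satisfiable; $f(\bar\alpha)=1$ if and only if $\phi_1(\bar y,\bar\alpha)$ is satisfiable; and the $\bar z$-variables appear in $\phi_0$ only negatively and in $\phi_1$ only positively. -}

module Defs where

open import Data.Nat using (ℕ; zero; suc; _+_; _^_; _≤_)
open import Data.Bool using (Bool; true; false; _∧_; _∨_; not)
import Data.Bool as B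
open import Data.Fin using (Fin)
open import Data.Vec using (Vec; []; _∷_; lookup; tabulate; head)
open import Data.Vec.Functional using (_++_)
open import Data.List using (List; length)
open import Data.List.Relation.Unary.All using (All)
open import Data.List.Relation.Unary.Any using (Any)
open import Data.Sum using (_⊎_; inj₁; inj₂)
open import Data.Product using (Σ; ∃; _×_)
open import Relation.Binary.PropositionalEquality using (_≡_)
open import Function.Bundles using (_⇔_)
open import Data.Empty using (⊥)
open import Data.Unit using (⊤)

BoolFam : Set
BoolFam = (n : ℕ) → (Fin n → Bool) → Bool

_≤ᵃ_ : ∀ {n} → (Fin n → Bool) → (Fin n → Bool) → Set
α ≤ᵃ β = ∀ i → α i B.≤ β i

Monotone : BoolFam → Set
Monotone f = ∀ n (α β : Fin n → Bool) → α ≤ᵃ β → f n α B.≤ f n β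

PolyBounded : (ℕ → ℕ) → Set
PolyBounded g = ∃ λ c → ∀ n → g n ≤ (n + c) ^ c

-- A gate whose inputs are among k previously computed wires.
data Gate (k : ℕ) : Set where
  CONST : Bool → Gate k
  NOT   : Fin k → Gate k
  AND   : Fin k → Fin k → Gate k
  OR    : Fin k → Fin k → Gate k

evalGate : ∀ {k} → Gate k → Vec Bool k → Bool
evalGate (CONST b) w = b
evalGate (NOT i)   w = not (lookup w i)
evalGate (AND i j) w = lookup w i ∧ lookup w j
evalGate (OR i j)  w = lookup w i ∨ lookup w j

-- Circuit m k : circuit on m inputs with k wires in total (inputs + gates).
data Circuit (m : ℕ) : ℕ → Set where
  inputs : Circuit m m
  _▷_    : ∀ {k} → Circuit m k → Gate k → Circuit m (suc k)

wires : ∀ {m k} → Circuit m k → (Fin m → Bool) → Vec Bool k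
wires inputs    α = tabulate α
wires (C ▷ g) α = evalGate g (wires C α) ∷ wires C α

-- Output = most recently added wire.
evalCircuit : ∀ {m k} → Circuit m (suc k) → (Fin m → Bool) → Bool
evalCircuit C α = head (wires C α)

InNPpoly : BoolFam → Set
InNPpoly f =
  Σ (ℕ → ℕ) λ w → Σ (ℕ → ℕ) λ s →
  Σ ((n : ℕ) → Circuit (n + w n) (suc (s n))) λ C →
    PolyBounded w × PolyBounded s ×
    (∀ n (α : Fin n → Bool) →
       (f n α ≡ true) ⇔ (∃ λ (β : Fin (w n) → Bool) → evalCircuit (C n) (α ++ β) ≡ true))

complement : BoolFam → BoolFam
complement f n α = not (f n α)

InCoNPpoly : BoolFam → Set
InCoNPpoly f = InNPpoly (complement f)

Var : ℕ → ℕ → Set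
Var a n = Fin a ⊎ Fin n     -- inj₁ = x̄/ȳ variable, inj₂ = z̄ variable

data Literal (a n : ℕ) : Set where
  pos : Var a n → Literal a n
  neg : Var a n → Literal a n

Clause : ℕ → ℕ → Set
Clause a n = List (Literal a n)

CNF : ℕ → ℕ → Set
CNF a n = List (Clause a n)

Is3CNF : ∀ {a n} → CNF a n → Set
Is3CNF φ = All (λ C → length C ≤ 3) φ

cnfSize : ∀ {a n} → CNF a n → ℕ
cnfSize = length

valVar : ∀ {a n} → (Fin a → Bool) → (Fin n → Bool) → Var a n → Bool
valVar β α (inj₁ i) = β i
valVar β α (inj₂ j) = α j

LitTrue : ∀ {a n} → (Fin a → Bool) → (Fin n → Bool) → Literal a n → Set
LitTrue β α (pos v) = valVar β α v ≡ true
LitTrue β α (neg v) = valVar β α v ≡ false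

SatBy : ∀ {a n} → CNF a n → (Fin a → Bool) → (Fin n → Bool) → Set
SatBy φ β α = All (Any (LitTrue β α)) φ

Satisfiable : ∀ {a n} → CNF a n → (Fin n → Bool) → Set
Satisfiable {a} φ α = ∃ λ (β : Fin a → Bool) → SatBy φ β α

NotPosZ : ∀ {a n} → Literal a n → Set
NotPosZ (pos (inj₂ _)) = ⊥
NotPosZ _ = ⊤

NotNegZ : ∀ {a n} → Literal a n → Set
NotNegZ (neg (inj₂ _)) = ⊥
NotNegZ _ = ⊤

ZOnlyNegative : ∀ {a n} → CNF a n → Set
ZOnlyNegative φ = All (All NotPosZ) φ

ZOnlyPositive : ∀ {a n} → CNF a n → Set
ZOnlyPositive φ = All (All NotNegZ) φ

{-# OPTIONS --safe #-}
-- Let C(z, w) be the NP/poly verifier of f and take one variable per wire of C. φ₁ consists of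
-- the Tseitin clauses of C, the unit clause asserting its output, and clauses x_i → z_i tying
-- the argument wires x to the shared variables z. A satisfying assignment is thus an accepting
-- run of C on some x ≤ α, and by monotonicity such a run exists iff f(α) = 1; the z-variables
-- occur only in the tying clauses, and there positively. φ₀ is built in the same way from the
-- verifier of ¬f, with tying clauses z_i → x_i, and works because ¬f is antitone.
module Submission where

open import Defs
open import Data.Bool using (Bool; true; false; not; _∧_; _∨_; T; f≤t; b≤b)
  renaming (_≤_ to _≤ᵇ_)
open import Data.Bool.ListAction using (all; any)
open import Data.Bool.Properties using (_≟_; T-≡; T-not-≡; ≤-minimum; ≤-maximum)
  renaming (≤-refl to ≤ᵇ-refl)
open import Data.Fin using (Fin; zero; suc; _↑ˡ_; _↑ʳ_; splitAt)
open import Data.Fin.Properties using (join-splitAt)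
open import Data.List using (List; []; _∷_; length; _++_)
import Data.List as List
open import Data.List.Properties using (length-++; length-tabulate)
open import Data.List.Relation.Unary.All as All using (All; []; _∷_)
open import Data.List.Relation.Unary.All.Properties
  using (++⁺; ++⁻; tabulate⁺; tabulate⁻; all⁺; all⁻)
open import Data.List.Relation.Unary.Any as Any using (Any; here; there)
open import Data.List.Relation.Unary.Any.Properties using (any⁺; any⁻)
open import Data.Nat using (ℕ; zero; suc; _+_; _*_; _^_; _≤_; z≤n; s≤s; NonZero; >-nonZero)
open import Data.Nat.Properties
  using (≤-refl; ≤-trans; ≤-reflexive; +-mono-≤; +-monoʳ-≤; *-mono-≤; *-monoˡ-≤;
         ^-monoˡ-≤; ^-monoʳ-≤; ^-distribˡ-+-*; m≤m+n; m≤n+m; m≤n⇒m≤1+n; m≤m*n; m^n≢0;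
         *-identityʳ; +-identityʳ; module ≤-Reasoning)
open import Data.Product using (Σ; ∃; ∃₂; _×_; _,_; proj₁; proj₂)
open import Data.Sum using (_⊎_; inj₁; inj₂; [_,_]′)
open import Data.Sum.Properties using ([,]-∘)
open import Data.Unit using (tt)
open import Data.Vec using ([]; _∷_; head; lookup; tabulate)
open import Data.Vec.Properties using (∷-injective; lookup∘tabulate; tabulate-cong; tabulate∘lookup)
import Data.Vec.Functional as Vector
open import Data.Vec.Functional.Properties using (lookup-++ˡ)
open import Data.Vec.Functional.Relation.Binary.Pointwise using (Pointwise)
open import Function using (_∘_; id; flip)
open import Function.Bundles using (_⇔_; mk⇔; Equivalence)
open import Function.Construct.Composition using (_⇔-∘_)
open import Function.Construct.Symmetry using (⇔-sym)
open import Level using (0ℓ)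
open import Relation.Binary.Core using (Rel)
open import Relation.Binary.Definitions using (Reflexive)
open import Relation.Binary.PropositionalEquality
  using (_≡_; refl; sym; trans; cong; cong₂; subst; _≗_)
open import Relation.Nullary.Decidable using (⌊_⌋; toWitness; fromWitness)

open Equivalence using (to; from)

variable
  a k K m n s w : ℕ
  g h : ℕ → ℕ

m+[1+n]≢0 : ∀ m n → NonZero (m + suc n)
m+[1+n]≢0 m n = >-nonZero (≤-trans (s≤s z≤n) (m≤n+m (suc n) m))

PolyBounded-mono : (∀ n → g n ≤ h n) → PolyBounded h → PolyBounded g
PolyBounded-mono g≤h (c , h≤) = c , λ n → ≤-trans (g≤h n) (h≤ n)

PolyBounded-const : ∀ k → PolyBounded (λ _ → k)
PolyBounded-const zero    = 0 , λ _ → z≤n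
PolyBounded-const (suc k) = suc k , λ n → let B = n + suc k in begin
  suc k      ≤⟨ m≤n+m (suc k) n ⟩
  B          ≤⟨ m≤m*n B (B ^ k) {{m^n≢0 B k {{m+[1+n]≢0 n k}}}} ⟩
  B * B ^ k  ∎
  where open ≤-Reasoning

PolyBounded-id : PolyBounded (λ n → n)
PolyBounded-id = 1 , λ n → ≤-trans (m≤m+n n 1) (≤-reflexive (sym (*-identityʳ (n + 1))))

PolyBounded-* : PolyBounded g → PolyBounded h → PolyBounded (λ n → g n * h n)
PolyBounded-* {g} {h} (c , g≤) (d , h≤) = c + d , λ n → let B = n + (c + d) in begin
  g n * h n                  ≤⟨ *-mono-≤ (g≤ n) (h≤ n) ⟩
  (n + c) ^ c * (n + d) ^ d  ≤⟨ *-mono-≤ (^-monoˡ-≤ c (+-monoʳ-≤ n (m≤m+n c d)))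
                                        (^-monoˡ-≤ d (+-monoʳ-≤ n (m≤n+m d c))) ⟩
  B ^ c * B ^ d              ≡⟨ ^-distribˡ-+-* B c d ⟨
  B ^ (c + d)                ∎
  where open ≤-Reasoning

-- The exponent is raised by two so that the base n + e is at least 2 and absorbs the factor 2 in
-- (n + e) ^ e′ + (n + e) ^ e′.
PolyBounded-+ : PolyBounded g → PolyBounded h → PolyBounded (λ n → g n + h n)
PolyBounded-+ {g} {h} (c , g≤) (d , h≤) = e , λ n → let B = n + e in begin
  g n + h n                  ≤⟨ +-mono-≤ (g≤ n) (h≤ n) ⟩
  (n + c) ^ c + (n + d) ^ d  ≤⟨ +-mono-≤ (lift n (≤-trans (m≤m+n c d) (m≤n+m _ 1)))
                                        (lift n (≤-trans (m≤n+m d c) (m≤n+m _ 1))) ⟩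
  B ^ e′ + B ^ e′            ≡⟨ cong (B ^ e′ +_) (sym (+-identityʳ (B ^ e′))) ⟩
  2 * B ^ e′                 ≤⟨ *-monoˡ-≤ (B ^ e′) (≤-trans (s≤s (s≤s z≤n)) (m≤n+m e n)) ⟩
  B * B ^ e′                 ∎
  where
  open ≤-Reasoning
  e′ = suc (c + d)
  e  = suc e′
  lift : ∀ n {x} → x ≤ e′ → (n + x) ^ x ≤ (n + e) ^ e′
  lift n {x} x≤e′ = ≤-trans (^-monoˡ-≤ x (+-monoʳ-≤ n (m≤n⇒m≤1+n x≤e′)))
                            (^-monoʳ-≤ (n + e) {{m+[1+n]≢0 n e′}} x≤e′)

≤ᵇ⇒≡false⊎≡true : ∀ {x y} → x ≤ᵇ y → x ≡ false ⊎ y ≡ true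
≤ᵇ⇒≡false⊎≡true f≤t           = inj₁ refl
≤ᵇ⇒≡false⊎≡true {false} b≤b   = inj₁ refl
≤ᵇ⇒≡false⊎≡true {true}  b≤b   = inj₂ refl

≤ᵇ-true : ∀ {x y} → x ≤ᵇ y → x ≡ true → y ≡ true
≤ᵇ-true b≤b refl = refl

≤ᵇ-false : ∀ {x y} → x ≤ᵇ y → y ≡ false → x ≡ false
≤ᵇ-false b≤b refl = refl

≡false⇔not≡true : ∀ {x} → x ≡ false ⇔ not x ≡ true
≡false⇔not≡true = T-≡ ⇔-∘ ⇔-sym T-not-≡

wire⁺ wire⁻ : Fin a → Literal a n
wire⁺ u = pos (inj₁ u)
wire⁻ u = neg (inj₁ u)

Private : Literal a n → Set
Private l = NotPosZ l × NotNegZ l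

literalValue : (Fin a → Bool) → (Fin n → Bool) → Literal a n → Bool
literalValue γ α (pos v) = valVar γ α v
literalValue γ α (neg v) = not (valVar γ α v)

cnfValue : (Fin a → Bool) → (Fin n → Bool) → CNF a n → Bool
cnfValue γ α = all (any (literalValue γ α))

implication : Var a n → Var a n → Clause a n
implication v v′ = neg v ∷ pos v′ ∷ []

module _ {γ : Fin a → Bool} {α : Fin n → Bool} where

  LitTrue⇔T : ∀ l → LitTrue γ α l ⇔ T (literalValue γ α l)
  LitTrue⇔T (pos v) = ⇔-sym T-≡
  LitTrue⇔T (neg v) = ⇔-sym T-not-≡

  SatBy⇔T : (φ : CNF a n) → SatBy φ γ α ⇔ T (cnfValue γ α φ)
  SatBy⇔T φ = mk⇔
    (λ sat → all⁻ _ (All.map (any⁺ _ ∘ Any.map (to (LitTrue⇔T _))) sat))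
    (λ t → All.map (Any.map (from (LitTrue⇔T _)) ∘ any⁻ _ _) (all⁺ _ φ t))

  implication-sat : ∀ v v′ → Any (LitTrue γ α) (implication v v′) ⇔ valVar γ α v ≤ᵇ valVar γ α v′
  implication-sat v v′ = mk⇔ sound ([ here , there ∘ here ]′ ∘ ≤ᵇ⇒≡false⊎≡true)
    where
    sound : Any (LitTrue γ α) (implication v v′) → valVar γ α v ≤ᵇ valVar γ α v′
    sound (here v≡false)        rewrite v≡false = ≤-minimum _
    sound (there (here v′≡true)) rewrite v′≡true = ≤-maximum _

lowerLink upperLink : Fin a → Fin n → Clause a n
lowerLink u i = implication (inj₁ u) (inj₂ i)
upperLink u i = implication (inj₂ i) (inj₁ u)

lowerLink-sat : (γ : Fin a → Bool) (α : Fin n → Bool) (u : Fin a) (i : Fin n) →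
                Any (LitTrue γ α) (lowerLink u i) ⇔ γ u ≤ᵇ α i
lowerLink-sat γ α u i = implication-sat (inj₁ u) (inj₂ i)

upperLink-sat : (γ : Fin a → Bool) (α : Fin n → Bool) (u : Fin a) (i : Fin n) →
                Any (LitTrue γ α) (upperLink u i) ⇔ α i ≤ᵇ γ u
upperLink-sat γ α u i = implication-sat (inj₂ i) (inj₁ u)

gateValue : Gate k → (Fin k → Bool) → Bool
gateValue (CONST b) x = b
gateValue (NOT i)   x = not (x i)
gateValue (AND i j) x = x i ∧ x j
gateValue (OR i j)  x = x i ∨ x j

evalGate-tabulate : (g : Gate k) (x : Fin k → Bool) → evalGate g (tabulate x) ≡ gateValue g x
evalGate-tabulate (CONST b) x = refl
evalGate-tabulate (NOT i)   x = cong not (lookup∘tabulate x i)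
evalGate-tabulate (AND i j) x = cong₂ _∧_ (lookup∘tabulate x i) (lookup∘tabulate x j)
evalGate-tabulate (OR i j)  x = cong₂ _∨_ (lookup∘tabulate x i) (lookup∘tabulate x j)

gateClauses : Gate k → Fin K → (Fin k → Fin K) → CNF K n
gateClauses (CONST true)  o ρ = (wire⁺ o ∷ []) ∷ []
gateClauses (CONST false) o ρ = (wire⁻ o ∷ []) ∷ []
gateClauses (NOT i)   o ρ = (wire⁺ o ∷ wire⁺ (ρ i) ∷ []) ∷ (wire⁻ o ∷ wire⁻ (ρ i) ∷ []) ∷ []
gateClauses (AND i j) o ρ =
  (wire⁻ o ∷ wire⁺ (ρ i) ∷ []) ∷ (wire⁻ o ∷ wire⁺ (ρ j) ∷ []) ∷
  (wire⁺ o ∷ wire⁻ (ρ i) ∷ wire⁻ (ρ j) ∷ []) ∷ []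
gateClauses (OR i j)  o ρ =
  (wire⁺ o ∷ wire⁻ (ρ i) ∷ []) ∷ (wire⁺ o ∷ wire⁻ (ρ j) ∷ []) ∷
  (wire⁻ o ∷ wire⁺ (ρ i) ∷ wire⁺ (ρ j) ∷ []) ∷ []

module _ (γ : Fin K → Bool) (α : Fin n → Bool) where

  gateClauses-value : (g : Gate k) (o : Fin K) (ρ : Fin k → Fin K) →
                      cnfValue γ α (gateClauses g o ρ) ≡ ⌊ γ o ≟ gateValue g (γ ∘ ρ) ⌋
  gateClauses-value (CONST true) o ρ with γ o
  ... | false = refl
  ... | true  = refl
  gateClauses-value (CONST false) o ρ with γ o
  ... | false = refl
  ... | true  = refl
  gateClauses-value (NOT i) o ρ with γ o | γ (ρ i)
  ... | false | false = refl
  ... | false | true  = refl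
  ... | true  | false = refl
  ... | true  | true  = refl
  gateClauses-value (AND i j) o ρ with γ o | γ (ρ i) | γ (ρ j)
  ... | false | false | false = refl
  ... | false | false | true  = refl
  ... | false | true  | false = refl
  ... | false | true  | true  = refl
  ... | true  | false | false = refl
  ... | true  | false | true  = refl
  ... | true  | true  | false = refl
  ... | true  | true  | true  = refl
  gateClauses-value (OR i j) o ρ with γ o | γ (ρ i) | γ (ρ j)
  ... | false | false | false = refl
  ... | false | false | true  = refl
  ... | false | true  | false = refl
  ... | false | true  | true  = refl
  ... | true  | false | false = refl
  ... | true  | false | true  = refl
  ... | true  | true  | false = refl
  ... | true  | true  | true  = refl

  gateClauses-sat : (g : Gate k) (o : Fin K) (ρ : Fin k → Fin K) →
                    SatBy (gateClauses g o ρ) γ α ⇔ (γ o ≡ gateValue g (γ ∘ ρ))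
  gateClauses-sat g o ρ = mk⇔
    (λ sat → toWitness (subst T value (to (SatBy⇔T _) sat)))
    (λ eq → from (SatBy⇔T _) (subst T (sym value) (fromWitness eq)))
    where value = gateClauses-value g o ρ

gateClauses-private : (g : Gate k) (o : Fin K) (ρ : Fin k → Fin K) →
                      All (All Private) (gateClauses {n = n} g o ρ)
gateClauses-private (CONST true)  o ρ = ((tt , tt) ∷ []) ∷ []
gateClauses-private (CONST false) o ρ = ((tt , tt) ∷ []) ∷ []
gateClauses-private (NOT i)   o ρ = ((tt , tt) ∷ (tt , tt) ∷ []) ∷ ((tt , tt) ∷ (tt , tt) ∷ []) ∷ []
gateClauses-private (AND i j) o ρ =
  ((tt , tt) ∷ (tt , tt) ∷ []) ∷ ((tt , tt) ∷ (tt , tt) ∷ []) ∷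
  ((tt , tt) ∷ (tt , tt) ∷ (tt , tt) ∷ []) ∷ []
gateClauses-private (OR i j)  o ρ =
  ((tt , tt) ∷ (tt , tt) ∷ []) ∷ ((tt , tt) ∷ (tt , tt) ∷ []) ∷
  ((tt , tt) ∷ (tt , tt) ∷ (tt , tt) ∷ []) ∷ []

gateClauses-3CNF : (g : Gate k) (o : Fin K) (ρ : Fin k → Fin K) → Is3CNF (gateClauses {n = n} g o ρ)
gateClauses-3CNF (CONST true)  o ρ = s≤s z≤n ∷ []
gateClauses-3CNF (CONST false) o ρ = s≤s z≤n ∷ []
gateClauses-3CNF (NOT i)   o ρ = s≤s (s≤s z≤n) ∷ s≤s (s≤s z≤n) ∷ []
gateClauses-3CNF (AND i j) o ρ = s≤s (s≤s z≤n) ∷ s≤s (s≤s z≤n) ∷ ≤-refl ∷ []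
gateClauses-3CNF (OR i j)  o ρ = s≤s (s≤s z≤n) ∷ s≤s (s≤s z≤n) ∷ ≤-refl ∷ []

gateClauses-length : (g : Gate k) (o : Fin K) (ρ : Fin k → Fin K) →
                     length (gateClauses {n = n} g o ρ) ≤ 3
gateClauses-length (CONST true)  o ρ = s≤s z≤n
gateClauses-length (CONST false) o ρ = s≤s z≤n
gateClauses-length (NOT i)   o ρ = s≤s (s≤s z≤n)
gateClauses-length (AND i j) o ρ = ≤-refl
gateClauses-length (OR i j)  o ρ = ≤-refl

tseitin : Circuit m k → (Fin k → Fin K) → CNF K n
tseitin inputs  ρ = []
tseitin (C ▷ g) ρ = gateClauses g (ρ zero) (ρ ∘ suc) ++ tseitin C (ρ ∘ suc)

inputWire : Circuit m k → Fin m → Fin k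
inputWire inputs  i = i
inputWire (C ▷ g) i = suc (inputWire C i)

lookup-inputWire : (C : Circuit m k) (x : Fin m → Bool) (i : Fin m) →
                   lookup (wires C x) (inputWire C i) ≡ x i
lookup-inputWire inputs  x i = lookup∘tabulate x i
lookup-inputWire (C ▷ g) x i = lookup-inputWire C x i

wires-cong : (C : Circuit m k) {x y : Fin m → Bool} → x ≗ y → wires C x ≡ wires C y
wires-cong inputs  x≗y = tabulate-cong x≗y
wires-cong (C ▷ g) x≗y = cong (λ v → evalGate g v ∷ v) (wires-cong C x≗y)

tseitin-sat : {γ : Fin K → Bool} {α : Fin n → Bool} (C : Circuit m k) (ρ : Fin k → Fin K) →
              SatBy (tseitin C ρ) γ α ⇔ (wires C (γ ∘ ρ ∘ inputWire C) ≡ tabulate (γ ∘ ρ))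
tseitin-sat inputs  ρ = mk⇔ (λ _ → refl) (λ _ → [])
tseitin-sat {γ = γ} {α} (C ▷ g) ρ = mk⇔
  (λ sat → let satG , satC = ++⁻ (gateClauses g _ _) sat ; run = to (tseitin-sat C (ρ ∘ suc)) satC
           in cong₂ _∷_ (trans (gate-output run) (sym (to (gateClauses-sat γ α g _ _) satG))) run)
  (λ run → let outG , runC = ∷-injective run
           in ++⁺ (from (gateClauses-sat γ α g _ _) (trans (sym outG) (gate-output runC)))
                  (from (tseitin-sat C (ρ ∘ suc)) runC))
  where
  gate-output : wires C (γ ∘ ρ ∘ suc ∘ inputWire C) ≡ tabulate (γ ∘ ρ ∘ suc) →
                evalGate g (wires C (γ ∘ ρ ∘ suc ∘ inputWire C)) ≡ gateValue g (γ ∘ ρ ∘ suc)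
  gate-output run = trans (cong (evalGate g) run) (evalGate-tabulate g (γ ∘ ρ ∘ suc))

tseitin-length : (C : Circuit m k) (ρ : Fin k → Fin K) → length (tseitin {n = n} C ρ) ≤ k * 3
tseitin-length inputs  ρ = z≤n
tseitin-length {n = n} (C ▷ g) ρ =
  ≤-trans (≤-reflexive (length-++ (gateClauses {n = n} g (ρ zero) (ρ ∘ suc))))
          (+-mono-≤ (gateClauses-length g (ρ zero) (ρ ∘ suc)) (tseitin-length C (ρ ∘ suc)))

tseitin-3CNF : (C : Circuit m k) (ρ : Fin k → Fin K) → Is3CNF (tseitin {n = n} C ρ)
tseitin-3CNF inputs  ρ = []
tseitin-3CNF (C ▷ g) ρ = ++⁺ (gateClauses-3CNF g (ρ zero) (ρ ∘ suc)) (tseitin-3CNF C (ρ ∘ suc))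

tseitin-private : (C : Circuit m k) (ρ : Fin k → Fin K) → All (All Private) (tseitin {n = n} C ρ)
tseitin-private inputs  ρ = []
tseitin-private (C ▷ g) ρ =
  ++⁺ (gateClauses-private g (ρ zero) (ρ ∘ suc)) (tseitin-private C (ρ ∘ suc))

split-++ : {A : Set} (x : Fin (m + n) → A) → (x ∘ (_↑ˡ n)) Vector.++ (x ∘ (m ↑ʳ_)) ≗ x
split-++ {m} {n} x i = trans (sym ([,]-∘ x (splitAt m i))) (cong x (join-splitAt m n i))

module _ (C : Circuit (n + w) (suc s)) (link : Fin (suc s) → Fin n → Clause (suc s) n) where

  argumentWire : Fin n → Fin (suc s)
  argumentWire i = inputWire C (i ↑ˡ w)

  -- The variables are the wires of C, wire zero being its output.
  circuitCNF : CNF (suc s) n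
  circuitCNF = (wire⁺ zero ∷ []) ∷ (List.tabulate (λ i → link (argumentWire i) i) ++ tseitin C id)

  AcceptsRelated : Rel Bool 0ℓ → (Fin n → Bool) → Set
  AcceptsRelated R α = ∃₂ λ x β → Pointwise R x α × evalCircuit C (x Vector.++ β) ≡ true

  circuitCNF-sat : (R : Rel Bool 0ℓ) → (∀ γ α u i → Any (LitTrue γ α) (link u i) ⇔ R (γ u) (α i)) →
                   ∀ α → Satisfiable circuitCNF α ⇔ AcceptsRelated R α
  circuitCNF-sat R link-sat α = mk⇔ sound complete
    where
    sound : Satisfiable circuitCNF α → AcceptsRelated R α
    sound (γ , here out ∷ rest) =
      let links , satC = ++⁻ (List.tabulate _) rest
          run = to (tseitin-sat C id) satC
      in γ ∘ argumentWire , γ ∘ inputWire C ∘ (n ↑ʳ_) ,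
         (λ i → to (link-sat γ α _ i) (tabulate⁻ links i)) ,
         trans (cong head (trans (wires-cong C (split-++ {n} {w} (γ ∘ inputWire C))) run)) out

    complete : AcceptsRelated R α → Satisfiable circuitCNF α
    complete (x , β , xRα , accepts) =
      γ , here out ∷ ++⁺ (tabulate⁺ links) (from (tseitin-sat C id) run)
      where
      y = x Vector.++ β
      γ = lookup (wires C y)
      run : wires C (γ ∘ inputWire C) ≡ tabulate γ
      run = trans (wires-cong C (lookup-inputWire C y)) (sym (tabulate∘lookup (wires C y)))
      out : γ zero ≡ true
      out = trans (cong head (tabulate∘lookup (wires C y))) accepts
      links : ∀ i → Any (LitTrue γ α) (link (argumentWire i) i)
      links i = from (link-sat γ α _ i) (subst (λ b → R b (α i)) (sym argument) (xRα i))
        where argument = trans (lookup-inputWire C y (i ↑ˡ w)) (lookup-++ˡ x β i)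

  circuitCNF-size : cnfSize circuitCNF ≤ suc (n + suc s * 3)
  circuitCNF-size = s≤s (≤-trans (≤-reflexive (trans (length-++ (List.tabulate L))
                                                     (cong (_+ _) (length-tabulate L))))
                                 (+-monoʳ-≤ n (tseitin-length C id)))
    where L = λ i → link (argumentWire i) i

  circuitCNF-3CNF : (∀ u i → length (link u i) ≤ 3) → Is3CNF circuitCNF
  circuitCNF-3CNF link≤3 = s≤s z≤n ∷ ++⁺ (tabulate⁺ (λ i → link≤3 _ i)) (tseitin-3CNF C id)

  circuitCNF-literals : {P : Literal (suc s) n → Set} → (∀ {l} → Private l → P l) →
                        (∀ u i → All P (link u i)) → All (All P) circuitCNF
  circuitCNF-literals private⇒P linkP =
    (private⇒P (tt , tt) ∷ []) ∷
    ++⁺ (tabulate⁺ (λ i → linkP _ i)) (All.map (All.map private⇒P) (tseitin-private C id))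

  circuitCNF-sat-upClosed : (R : Rel Bool 0ℓ) {Q : (Fin n → Bool) → Set} →
    (∀ γ α u i → Any (LitTrue γ α) (link u i) ⇔ R (γ u) (α i)) → Reflexive R →
    (∀ {x y} → Pointwise R x y → Q x → Q y) →
    (∀ x → Q x ⇔ ∃ λ β → evalCircuit C (x Vector.++ β) ≡ true) →
    ∀ α → Q α ⇔ Satisfiable circuitCNF α
  circuitCNF-sat-upClosed R link-sat R-refl Q-closed Q⇔accepted α = mk⇔
    (λ Qα → let β , accepts = to (Q⇔accepted α) Qα
            in from (circuitCNF-sat R link-sat α) (α , β , (λ _ → R-refl) , accepts))
    (λ sat → let x , β , xRα , accepts = to (circuitCNF-sat R link-sat α) sat
             in Q-closed xRα (from (Q⇔accepted x) (β , accepts)))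

lemma3p9 : (f : BoolFam) → Monotone f → InNPpoly f → InCoNPpoly f →
    Σ (ℕ → ℕ) λ a₀ → Σ (ℕ → ℕ) λ a₁ →
    Σ ((n : ℕ) → CNF (a₀ n) n) λ φ₀ → Σ ((n : ℕ) → CNF (a₁ n) n) λ φ₁ →
      PolyBounded a₀ × PolyBounded a₁ ×
      PolyBounded (λ n → cnfSize (φ₀ n)) × PolyBounded (λ n → cnfSize (φ₁ n)) ×
      (∀ n → Is3CNF (φ₀ n)) × (∀ n → Is3CNF (φ₁ n)) ×
      (∀ n (α : Fin n → Bool) → (f n α ≡ false) ⇔ Satisfiable (φ₀ n) α) ×
      (∀ n (α : Fin n → Bool) → (f n α ≡ true) ⇔ Satisfiable (φ₁ n) α) ×
      (∀ n → ZOnlyNegative (φ₀ n)) × (∀ n → ZOnlyPositive (φ₁ n))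
-- The witness lengths need no bound of their own: witness bits are wires of the circuits.
lemma3p9 f monotone (_ , s₁ , C₁ , _ , s₁-poly , accepts₁) (_ , s₀ , C₀ , _ , s₀-poly , accepts₀) =
  suc ∘ s₀ , suc ∘ s₁ ,
  (λ n → circuitCNF (C₀ n) upperLink) , (λ n → circuitCNF (C₁ n) lowerLink) ,
  suc-poly s₀-poly , suc-poly s₁-poly ,
  PolyBounded-mono (λ n → circuitCNF-size (C₀ n) upperLink) (size-poly s₀-poly) ,
  PolyBounded-mono (λ n → circuitCNF-size (C₁ n) lowerLink) (size-poly s₁-poly) ,
  (λ n → circuitCNF-3CNF (C₀ n) upperLink (λ _ _ → s≤s (s≤s z≤n))) ,
  (λ n → circuitCNF-3CNF (C₁ n) lowerLink (λ _ _ → s≤s (s≤s z≤n))) ,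
  (λ n → circuitCNF-sat-upClosed (C₀ n) upperLink (flip _≤ᵇ_) upperLink-sat ≤ᵇ-refl
           (λ y≤x → ≤ᵇ-false (monotone n _ _ y≤x)) (λ x → accepts₀ n x ⇔-∘ ≡false⇔not≡true)) ,
  (λ n → circuitCNF-sat-upClosed (C₁ n) lowerLink _≤ᵇ_ lowerLink-sat ≤ᵇ-refl
           (λ x≤y → ≤ᵇ-true (monotone n _ _ x≤y)) (accepts₁ n)) ,
  (λ n → circuitCNF-literals (C₀ n) upperLink proj₁ (λ _ _ → tt ∷ tt ∷ [])) ,
  (λ n → circuitCNF-literals (C₁ n) lowerLink proj₂ (λ _ _ → tt ∷ tt ∷ []))
  where
  suc-poly : PolyBounded g → PolyBounded (suc ∘ g)
  suc-poly = PolyBounded-+ (PolyBounded-const 1)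
  size-poly : PolyBounded g → PolyBounded (λ n → suc (n + suc (g n) * 3))
  size-poly g-poly =
    suc-poly (PolyBounded-+ PolyBounded-id (PolyBounded-* (suc-poly g-poly) (PolyBounded-const 3)))
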